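{- Let $w_1,w_2,w_3$ be positively dependent vectors in $\mathbb{R}^2$ and let $H(w_1,w_2,w_3)$ be the convex hull of $w_1,w_1+w_2,w_2,w_2+w_3,w_3,w_1+w_3$. Let $C_1=\{\alpha w_2 + \beta w_3 : 0 \le \alpha,\beta \le 1\}$, $C_2=\{\alpha w_1 + \beta w_3 : 0 \le \alpha,\beta \le 1\}$ and $C_3=\{\alpha w_1 + \beta w_2 : 0 \le \alpha,\beta \le 1\}$. Then $$H (w_1,w_2,w_3)=\bigcup^3_{i=1} C_i = \bigcup^3_{i=1} (w_i+C_i).$$
   Context: Vectors $w_1,\dots,w_{d+1}\in\mathbb{R}^d$ are positively dependent if they span $\mathbb{R}^d$ and there exist positive reals $a_1,\dots,a_{d+1}$ with $a_1w_1+\cdots+a_{d+1}w_{d+1}=0$. -}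

module Defs where

open import Level using (0ℓ)
open import Data.Product using (Σ; ∃; ∃-syntax; _×_; _,_)
open import Data.Sum using (_⊎_)
open import Data.Nat using (ℕ; zero; suc)
open import Data.Fin using (Fin; zero; suc)
open import Relation.Binary.PropositionalEquality using (_≡_; _≢_)
open import Relation.Binary using (Trichotomous)
open import Function.Bundles using (_⇔_)

record Reals : Set₁ where
  infixl 6 _+_
  infixl 7 _*_
  infix 4 _<_ _≤_
  field
    ℝ : Set
    0# 1# : ℝ
    _+_ _*_ : ℝ → ℝ → ℝ
    -_ : ℝ → ℝ
    inv : (x : ℝ) → x ≢ 0# → ℝ
    _<_ : ℝ → ℝ → Set
    +-assoc : ∀ x y z → (x + y) + z ≡ x + (y + z)
    +-comm : ∀ x y → x + y ≡ y + x
    +-identityˡ : ∀ x → 0# + x ≡ x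
    +-inverseˡ : ∀ x → (- x) + x ≡ 0#
    *-assoc : ∀ x y z → (x * y) * z ≡ x * (y * z)
    *-comm : ∀ x y → x * y ≡ y * x
    *-identityˡ : ∀ x → 1# * x ≡ x
    *-inverseˡ : ∀ x (p : x ≢ 0#) → inv x p * x ≡ 1#
    distribˡ : ∀ x y z → x * (y + z) ≡ x * y + x * z
    0≢1 : 0# ≢ 1#
    <-trans : ∀ {x y z} → x < y → y < z → x < z
    <-tri : Trichotomous _≡_ _<_
    +-monoˡ-< : ∀ {x y} z → x < y → x + z < y + z
    *-pos : ∀ {x y} → 0# < x → 0# < y → 0# < x * y

  _≤_ : ℝ → ℝ → Set
  x ≤ y = x < y ⊎ x ≡ y

  field
    sup : (P : ℝ → Set) → ∃ P → (∃[ b ] (∀ x → P x → x ≤ b)) →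
          ∃[ s ] ((∀ x → P x → x ≤ s) × (∀ b → (∀ x → P x → x ≤ b) → s ≤ b))

module Plane (R : Reals) where
  open Reals R

  V2 : Set
  V2 = ℝ × ℝ

  _⊕_ : V2 → V2 → V2
  (a , b) ⊕ (c , d) = (a + c , b + d)

  _·_ : ℝ → V2 → V2
  t · (a , b) = (t * a , t * b)

  𝟎 : V2
  𝟎 = (0# , 0#)

  Σℝ : ∀ {n} → (Fin n → ℝ) → ℝ
  Σℝ {zero} f = 0#
  Σℝ {suc n} f = f zero + Σℝ (λ i → f (suc i))

  ΣV : ∀ {n} → (Fin n → V2) → V2
  ΣV {zero} f = 𝟎
  ΣV {suc n} f = f zero ⊕ ΣV (λ i → f (suc i))

  Spans : V2 → V2 → V2 → Set
  Spans w₁ w₂ w₃ = ∀ v → ∃[ a ] ∃[ b ] ∃[ c ] ((a · w₁) ⊕ (b · w₂)) ⊕ (c · w₃) ≡ v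

  PositivelyDependent : V2 → V2 → V2 → Set
  PositivelyDependent w₁ w₂ w₃ =
    Spans w₁ w₂ w₃ ×
    (∃[ a ] ∃[ b ] ∃[ c ] (0# < a × 0# < b × 0# < c ×
       ((a · w₁) ⊕ (b · w₂)) ⊕ (c · w₃) ≡ 𝟎))

  ConvexHull : ∀ {n} → (Fin n → V2) → V2 → Set
  ConvexHull {n} p x =
    ∃[ λs ] ((∀ i → 0# ≤ λs i) × Σℝ {n} λs ≡ 1# × ΣV (λ i → λs i · p i) ≡ x)

  six : V2 → V2 → V2 → Fin 6 → V2
  six w₁ w₂ w₃ zero = w₁
  six w₁ w₂ w₃ (suc zero) = w₁ ⊕ w₂
  six w₁ w₂ w₃ (suc (suc zero)) = w₂
  six w₁ w₂ w₃ (suc (suc (suc zero))) = w₂ ⊕ w₃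
  six w₁ w₂ w₃ (suc (suc (suc (suc zero)))) = w₃
  six w₁ w₂ w₃ (suc (suc (suc (suc (suc zero))))) = w₁ ⊕ w₃

  H : V2 → V2 → V2 → V2 → Set
  H w₁ w₂ w₃ = ConvexHull (six w₁ w₂ w₃)

  Par : V2 → V2 → V2 → Set
  Par u v x = ∃[ α ] ∃[ β ] (0# ≤ α × α ≤ 1# × 0# ≤ β × β ≤ 1# × (α · u) ⊕ (β · v) ≡ x)

  Tr : V2 → (V2 → Set) → V2 → Set
  Tr w C x = ∃[ y ] (C y × w ⊕ y ≡ x)

  Union3 : (V2 → Set) → (V2 → Set) → (V2 → Set) → V2 → Set
  Union3 A B C x = A x ⊎ B x ⊎ C x

  SetEq : (V2 → Set) → (V2 → Set) → Set
  SetEq A B = ∀ x → A x ⇔ B x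

-- All three sets equal the zonotope Z = { x w₁ + y w₂ + z w₃ : (x, y, z) ∈ [0,1]³ }.
-- Since a w₁ + b w₂ + c w₃ = 0 with a, b, c > 0, sliding a coefficient triple along (a, b, c)
-- does not move the point.  Sliding a triple of the cube until a coordinate reaches 0 (or 1)
-- shows that every point of Z lies in some Cᵢ (or wᵢ + Cᵢ); the converse inclusions are immediate.
-- The coefficients of a convex combination of the six vertices of H lie in [0,1]³, so H ⊆ Z.
-- Conversely, a point of the cube is the trilinear convex combination of the eight vertices of the
-- cube.  Six of them are mapped to the vertices of H, and the other two to 0 and w₁ + w₂ + w₃, which
-- are the convex combinations of w₁, w₂, w₃ and of w₂ + w₃, w₁ + w₃, w₁ + w₂ with weights
-- proportional to a, b, c.  Hence Z ⊆ H.

module Submission where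

open import Defs
open import Level using (0ℓ)
open import Algebra.Bundles using (CommutativeRing; RawRing)
open import Algebra.Consequences.Propositional using (comm∧idˡ⇒id; comm∧invˡ⇒inv; comm∧distrˡ⇒distr)
open import Algebra.Solver.Ring.AlmostCommutativeRing
  using (_-Raw-AlmostCommutative⟶_; fromCommutativeRing)
open import Data.Empty using (⊥-elim)
open import Data.Fin using (Fin)
open import Data.Fin.Patterns using (0F; 1F; 2F; 3F; 4F; 5F)
open import Data.Integer as ℤ using (ℤ; +_; -[1+_]; _⊖_; ∣_∣; sign; _◃_)
import Data.Integer.Properties as ℤ
open import Data.Maybe using (Maybe; just; nothing)
open import Data.Nat as ℕ using (zero; suc)
import Data.Nat.Properties as ℕ
open import Data.Product using (∃-syntax; _×_; _,_; proj₁; proj₂; uncurry)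
open import Data.Sign as Sign using (Sign)
open import Data.Sum using (_⊎_; inj₁; inj₂)
open import Data.Vec.Functional using (_∷_; [])
open import Function.Bundles using (mk⇔)
open import Relation.Binary using (tri<; tri≈; tri>)
open import Relation.Binary.PropositionalEquality as ≡ using (_≡_; cong; cong₂; subst; subst₂)
open import Relation.Nullary using (¬_; yes; no)
open import Relation.Unary using (_⊆_)

-- ℤ maps into every commutative ring, so it can serve as the solver's coefficient ring.
-- The optimised multiple _×′_ has 1 ×′ 1# = 1#, so that the solver's constant con (+ 1) evaluates to 1#
-- itself and its conclusions match goals written with 1#.
module IntegerCoefficients {c ℓ} (R : CommutativeRing c ℓ) where
  open CommutativeRing R
  open import Algebra.Properties.Semiring.Mult.TCOptimised semiring using (1+×; ×-homo-+; ×1-homo-*) renaming (_×_ to _×′_)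
  open import Algebra.Properties.Ring ring using (-0#≈0#; -‿involutive; -‿+-comm; -1*x≈-x)
  open import Relation.Binary.Reasoning.Setoid setoid

  fromℤ : ℤ → Carrier
  fromℤ (+ n) = n ×′ 1#
  fromℤ -[1+ n ] = - (suc n ×′ 1#)

  private
    x≈x-0 : ∀ x → x ≈ x - 0#
    x≈x-0 x = begin
      x        ≈⟨ +-identityʳ x ⟨
      x + 0#   ≈⟨ +-congˡ -0#≈0# ⟨
      x - 0#   ∎

    [1+x]-[1+y] : ∀ x y → (1# + x) - (1# + y) ≈ x - y
    [1+x]-[1+y] x y = begin
      (1# + x) - (1# + y)      ≈⟨ +-congˡ (-‿+-comm 1# y) ⟨
      (1# + x) + (- 1# - y)    ≈⟨ +-congʳ (+-comm 1# x) ⟩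
      (x + 1#) + (- 1# - y)    ≈⟨ +-assoc x 1# _ ⟩
      x + (1# + (- 1# - y))    ≈⟨ +-congˡ (+-assoc 1# (- 1#) _) ⟨
      x + ((1# - 1#) - y)      ≈⟨ +-congˡ (+-congʳ (-‿inverseʳ 1#)) ⟩
      x + (0# - y)             ≈⟨ +-congˡ (+-identityˡ _) ⟩
      x - y                    ∎

  ⊖-homo : ∀ m n → fromℤ (m ⊖ n) ≈ m ×′ 1# - n ×′ 1#
  ⊖-homo zero zero = sym (-‿inverseʳ 0#)
  ⊖-homo zero (suc n) = sym (+-identityˡ _)
  ⊖-homo (suc m) zero = x≈x-0 _
  ⊖-homo (suc m) (suc n) = begin
    fromℤ (suc m ⊖ suc n)             ≡⟨ cong fromℤ (ℤ.[1+m]⊖[1+n]≡m⊖n m n) ⟩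
    fromℤ (m ⊖ n)                     ≈⟨ ⊖-homo m n ⟩
    m ×′ 1# - n ×′ 1#                 ≈⟨ [1+x]-[1+y] _ _ ⟨
    (1# + m ×′ 1#) - (1# + n ×′ 1#)   ≈⟨ +-cong (1+× m 1#) (-‿cong (1+× n 1#)) ⟨
    suc m ×′ 1# - suc n ×′ 1#         ∎

  -‿homo : ∀ i → fromℤ (ℤ.- i) ≈ - fromℤ i
  -‿homo (+ zero) = sym -0#≈0#
  -‿homo (+ suc n) = refl
  -‿homo -[1+ n ] = sym (-‿involutive _)

  +-homo : ∀ i j → fromℤ (i ℤ.+ j) ≈ fromℤ i + fromℤ j
  +-homo -[1+ m ] -[1+ n ] = begin
    - (suc (suc (m ℕ.+ n)) ×′ 1#)     ≡⟨ cong (λ k → - (suc k ×′ 1#)) (ℕ.+-suc m n) ⟨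
    - ((suc m ℕ.+ suc n) ×′ 1#)       ≈⟨ -‿cong (×-homo-+ 1# (suc m) (suc n)) ⟩
    - (suc m ×′ 1# + suc n ×′ 1#)     ≈⟨ -‿+-comm _ _ ⟨
    fromℤ -[1+ m ] + fromℤ -[1+ n ]   ∎
  +-homo -[1+ m ] (+ n) = trans (⊖-homo n (suc m)) (+-comm _ _)
  +-homo (+ m) -[1+ n ] = ⊖-homo m (suc n)
  +-homo (+ m) (+ n) = ×-homo-+ 1# m n

  private
    signed : Sign → Carrier
    signed Sign.+ = 1#
    signed Sign.- = - 1#

    signed-homo : ∀ s t → signed (s Sign.* t) ≈ signed s * signed t
    signed-homo Sign.+ Sign.+ = sym (*-identityˡ 1#)
    signed-homo Sign.+ Sign.- = sym (*-identityˡ (- 1#))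
    signed-homo Sign.- Sign.+ = sym (*-identityʳ (- 1#))
    signed-homo Sign.- Sign.- = sym (trans (-1*x≈-x (- 1#)) (-‿involutive 1#))

    ◃-homo : ∀ s n → fromℤ (s ◃ n) ≈ signed s * (n ×′ 1#)
    ◃-homo s zero = sym (zeroʳ _)
    ◃-homo Sign.+ (suc n) = sym (*-identityˡ _)
    ◃-homo Sign.- (suc n) = sym (-1*x≈-x _)

    sign-abs : ∀ i → fromℤ i ≈ signed (sign i) * (∣ i ∣ ×′ 1#)
    sign-abs (+ n) = sym (*-identityˡ _)
    sign-abs -[1+ n ] = sym (-1*x≈-x _)

  *-homo : ∀ i j → fromℤ (i ℤ.* j) ≈ fromℤ i * fromℤ j
  *-homo i j = begin
    fromℤ (i ℤ.* j)
      ≈⟨ ◃-homo (sign i Sign.* sign j) (∣ i ∣ ℕ.* ∣ j ∣) ⟩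
    signed (sign i Sign.* sign j) * ((∣ i ∣ ℕ.* ∣ j ∣) ×′ 1#)
      ≈⟨ *-cong (signed-homo (sign i) (sign j)) (×1-homo-* ∣ i ∣ ∣ j ∣) ⟩
    (signed (sign i) * signed (sign j)) * ((∣ i ∣ ×′ 1#) * (∣ j ∣ ×′ 1#))
      ≈⟨ interchange _ _ _ _ ⟩
    (signed (sign i) * (∣ i ∣ ×′ 1#)) * (signed (sign j) * (∣ j ∣ ×′ 1#))
      ≈⟨ *-cong (sign-abs i) (sign-abs j) ⟨
    fromℤ i * fromℤ j
      ∎
    where open import Algebra.Properties.CommutativeSemigroup *-commutativeSemigroup using (interchange)

  homomorphism : ℤ.+-*-rawRing -Raw-AlmostCommutative⟶ fromCommutativeRing R
  homomorphism = record
    { ⟦_⟧ = fromℤ ; +-homo = +-homo ; *-homo = *-homo ; -‿homo = -‿homo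
    ; 0-homo = refl ; 1-homo = refl }

  private
    dec : ∀ i j → Maybe (fromℤ i ≈ fromℤ j)
    dec i j with i ℤ.≟ j
    ... | yes ≡.refl = just refl
    ... | no _ = nothing

  open import Algebra.Solver.Ring ℤ.+-*-rawRing (fromCommutativeRing R) homomorphism dec public

module RealsProperties (R : Reals) where
  open Reals R

  commutativeRing : CommutativeRing 0ℓ 0ℓ
  commutativeRing = record
    { Carrier = ℝ ; _≈_ = _≡_ ; _+_ = _+_ ; _*_ = _*_ ; -_ = -_ ; 0# = 0# ; 1# = 1#
    ; isCommutativeRing = record
      { isRing = record
        { +-isAbelianGroup = record
          { isGroup = record
            { isMonoid = record
              { isSemigroup = record
                { isMagma = record { isEquivalence = ≡.isEquivalence ; ∙-cong = cong₂ _+_ }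
                ; assoc = +-assoc }
              ; identity = comm∧idˡ⇒id +-comm +-identityˡ }
            ; inverse = comm∧invˡ⇒inv +-comm +-inverseˡ
            ; ⁻¹-cong = cong -_ }
          ; comm = +-comm }
        ; *-cong = cong₂ _*_
        ; *-assoc = *-assoc
        ; *-identity = comm∧idˡ⇒id *-comm *-identityˡ
        ; distrib = comm∧distrˡ⇒distr (cong₂ _+_) *-comm distribˡ }
      ; *-comm = *-comm } }

  open IntegerCoefficients commutativeRing public using (Polynomial; solve; _:=_; con; _:+_; _:*_; _:-_; :-_)

  rawRing : RawRing 0ℓ 0ℓ
  rawRing = CommutativeRing.rawRing commutativeRing

  polynomialRawRing : ∀ n → RawRing 0ℓ 0ℓ
  polynomialRawRing n = record
    { Carrier = Polynomial n ; _≈_ = _≡_ ; _+_ = _:+_ ; _*_ = _:*_ ; -_ = :-_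
    ; 0# = con (+ 0) ; 1# = con (+ 1) }

  infixl 6 _-_
  _-_ : ℝ → ℝ → ℝ
  x - y = x + - y

  <-irrefl : ∀ {x} → ¬ x < x
  <-irrefl {x} x<x with <-tri x x
  ... | tri< _ x≢x _ = x≢x ≡.refl
  ... | tri≈ x≮x _ _ = x≮x x<x
  ... | tri> x≮x _ _ = x≮x x<x

  <-asym : ∀ {x y} → x < y → ¬ y < x
  <-asym x<y y<x = <-irrefl (<-trans x<y y<x)

  ≤-trans : ∀ {x y z} → x ≤ y → y ≤ z → x ≤ z
  ≤-trans (inj₁ x<y) (inj₁ y<z) = inj₁ (<-trans x<y y<z)
  ≤-trans (inj₁ x<y) (inj₂ ≡.refl) = inj₁ x<y
  ≤-trans (inj₂ ≡.refl) y≤z = y≤z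

  ≤-total : ∀ x y → x ≤ y ⊎ y ≤ x
  ≤-total x y with <-tri x y
  ... | tri< x<y _ _ = inj₁ (inj₁ x<y)
  ... | tri≈ _ x≡y _ = inj₁ (inj₂ x≡y)
  ... | tri> _ _ y<x = inj₂ (inj₁ y<x)

  +-monoˡ-≤ : ∀ {x y} z → x ≤ y → x + z ≤ y + z
  +-monoˡ-≤ z (inj₁ x<y) = inj₁ (+-monoˡ-< z x<y)
  +-monoˡ-≤ z (inj₂ ≡.refl) = inj₂ ≡.refl

  x≤y⇒0≤y-x : ∀ {x y} → x ≤ y → 0# ≤ y - x
  x≤y⇒0≤y-x {x} {y} x≤y =
    subst (_≤ y - x) (solve 1 (λ x → x :- x := con (+ 0)) ≡.refl x) (+-monoˡ-≤ (- x) x≤y)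

  0≤y-x⇒x≤y : ∀ {x y} → 0# ≤ y - x → x ≤ y
  0≤y-x⇒x≤y {x} {y} 0≤y-x =
    subst₂ _≤_ (+-identityˡ x) (solve 2 (λ x y → (y :- x) :+ x := y) ≡.refl x y) (+-monoˡ-≤ x 0≤y-x)

  x<0⇒0<-x : ∀ {x} → x < 0# → 0# < - x
  x<0⇒0<-x {x} x<0 = subst₂ _<_ (solve 1 (λ x → x :- x := con (+ 0)) ≡.refl x) (+-identityˡ (- x)) (+-monoˡ-< (- x) x<0)

  +-pos : ∀ {x y} → 0# < x → 0# < y → 0# < x + y
  +-pos {x} {y} 0<x 0<y = <-trans 0<y (subst₂ _<_ (+-identityˡ y) ≡.refl (+-monoˡ-< y 0<x))

  +-nonneg : ∀ {x y} → 0# ≤ x → 0# ≤ y → 0# ≤ x + y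
  +-nonneg {x} {y} 0≤x 0≤y = ≤-trans 0≤y (subst₂ _≤_ (+-identityˡ y) ≡.refl (+-monoˡ-≤ y 0≤x))

  *-nonneg : ∀ {x y} → 0# ≤ x → 0# ≤ y → 0# ≤ x * y
  *-nonneg (inj₁ 0<x) (inj₁ 0<y) = inj₁ (*-pos 0<x 0<y)
  *-nonneg {x} _ (inj₂ ≡.refl) = inj₂ (solve 1 (λ x → con (+ 0) := x :* con (+ 0)) ≡.refl x)
  *-nonneg {_} {y} (inj₂ ≡.refl) _ = inj₂ (solve 1 (λ y → con (+ 0) := con (+ 0) :* y) ≡.refl y)

  0<-x⇒x<0 : ∀ {x} → 0# < - x → x < 0#
  0<-x⇒x<0 {x} 0<-x = subst₂ _<_ (+-identityˡ x) (solve 1 (λ x → :- x :+ x := con (+ 0)) ≡.refl x) (+-monoˡ-< x 0<-x)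

  0<1 : 0# < 1#
  0<1 with <-tri 0# 1#
  ... | tri< 0<1 _ _ = 0<1
  ... | tri≈ _ 0≡1 _ = ⊥-elim (0≢1 0≡1)
  ... | tri> _ _ 1<0 = ⊥-elim (<-asym 1<0 (subst (0# <_) -1*-1≡1 (*-pos 0<-1 0<-1)))
    where
      0<-1 : 0# < - 1#
      0<-1 = x<0⇒0<-x 1<0
      -1*-1≡1 : - 1# * - 1# ≡ 1#
      -1*-1≡1 = solve 0 (:- con (+ 1) :* :- con (+ 1) := con (+ 1)) ≡.refl

  recip : ∀ {x} → 0# < x → ℝ
  recip {x} 0<x = inv x (λ x≡0 → <-irrefl (subst (0# <_) x≡0 0<x))

  recip-inverse : ∀ {x} (0<x : 0# < x) → recip 0<x * x ≡ 1#
  recip-inverse {x} 0<x = *-inverseˡ x _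

  recip-cancelʳ : ∀ {d} (0<d : 0# < d) x → x * recip 0<d * d ≡ x
  recip-cancelʳ {d} 0<d x = ≡.trans (*-assoc x _ d)
    (≡.trans (cong (x *_) (recip-inverse 0<d)) (solve 1 (λ x → x :* con (+ 1) := x) ≡.refl x))

  recip-nonneg : ∀ {x} (0<x : 0# < x) → 0# ≤ recip 0<x
  recip-nonneg {x} 0<x with <-tri 0# (recip 0<x)
  ... | tri< 0<r _ _ = inj₁ 0<r
  ... | tri≈ _ 0≡r _ = inj₂ 0≡r
  ... | tri> _ _ r<0 = ⊥-elim (<-asym 0<1 (0<-x⇒x<0 (subst (0# <_) -r*x≡-1 (*-pos (x<0⇒0<-x r<0) 0<x))))
    where
      -r*x≡-1 : - recip 0<x * x ≡ - 1#
      -r*x≡-1 = ≡.trans (solve 2 (λ r x → :- r :* x := :- (r :* x)) ≡.refl _ x) (cong -_ (recip-inverse 0<x))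

  minimum₃ : ∀ r₁ r₂ r₃ → (r₁ ≤ r₂ × r₁ ≤ r₃) ⊎ (r₂ ≤ r₁ × r₂ ≤ r₃) ⊎ (r₃ ≤ r₁ × r₃ ≤ r₂)
  minimum₃ r₁ r₂ r₃ with ≤-total r₁ r₂ | ≤-total r₁ r₃ | ≤-total r₂ r₃
  ... | inj₁ r₁≤r₂ | inj₁ r₁≤r₃ | _          = inj₁ (r₁≤r₂ , r₁≤r₃)
  ... | inj₁ r₁≤r₂ | inj₂ r₃≤r₁ | _          = inj₂ (inj₂ (r₃≤r₁ , ≤-trans r₃≤r₁ r₁≤r₂))
  ... | inj₂ r₂≤r₁ | _          | inj₁ r₂≤r₃ = inj₂ (inj₁ (r₂≤r₁ , r₂≤r₃))
  ... | inj₂ r₂≤r₁ | _          | inj₂ r₃≤r₂ = inj₂ (inj₂ (≤-trans r₃≤r₂ r₂≤r₁ , r₃≤r₂))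

-- Weights of the cube point (x, y, z) on the six vertices of H, in the order of `six`: the trilinear
-- weight pᵢⱼₖ of each vertex of the cube, except that the masses p₀₀₀ and p₁₁₁ of 0 and (1,1,1) are
-- spread as k₀ (a, b, c) over w₁, w₂, w₃ and as k₁ (a, b, c) over w₂ + w₃, w₁ + w₃, w₁ + w₂,
-- where σ = 1 / (a + b + c).
-- Stated over any raw ring so that the ring solver can verify identities between these expressions.
module HexagonWeights {c ℓ} (R : RawRing c ℓ) (x y z a b c σ : RawRing.Carrier R) where
  open RawRing R

  x′ y′ z′ : Carrier
  x′ = 1# + - x
  y′ = 1# + - y
  z′ = 1# + - z

  p₀₀₀ p₁₀₀ p₀₁₀ p₀₀₁ p₁₁₀ p₀₁₁ p₁₀₁ p₁₁₁ : Carrier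
  p₀₀₀ = x′ * y′ * z′
  p₁₀₀ = x * y′ * z′
  p₀₁₀ = x′ * y * z′
  p₀₀₁ = x′ * y′ * z
  p₁₁₀ = x * y * z′
  p₀₁₁ = x′ * y * z
  p₁₀₁ = x * y′ * z
  p₁₁₁ = x * y * z

  k₀ k₁ shift : Carrier
  k₀ = p₀₀₀ * σ
  k₁ = p₁₁₁ * σ
  shift = k₀ + - k₁

  n₀ n₁ n₂ n₃ n₄ n₅ : Carrier
  n₀ = p₁₀₀ + k₀ * a
  n₁ = p₁₁₀ + k₁ * c
  n₂ = p₀₁₀ + k₀ * b
  n₃ = p₀₁₁ + k₁ * a
  n₄ = p₀₀₁ + k₀ * c
  n₅ = p₁₀₁ + k₁ * b

module UnitCube (R : Reals) where
  open Reals R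
  open Plane R using (Σℝ)
  open RealsProperties R

  infix 4 _∈[0,1]
  _∈[0,1] : ℝ → Set
  x ∈[0,1] = 0# ≤ x × x ≤ 1#

  0∈[0,1] : 0# ∈[0,1]
  0∈[0,1] = inj₂ ≡.refl , inj₁ 0<1

  1∈[0,1] : 1# ∈[0,1]
  1∈[0,1] = inj₁ 0<1 , inj₂ ≡.refl

  1-‿∈[0,1] : ∀ {x} → x ∈[0,1] → 1# - x ∈[0,1]
  1-‿∈[0,1] {x} (0≤x , x≤1) =
    x≤y⇒0≤y-x x≤1 , 0≤y-x⇒x≤y (subst (0# ≤_) (solve 1 (λ x → x := con (+ 1) :- (con (+ 1) :- x)) ≡.refl x) 0≤x)

  summand-∈[0,1] : ∀ {x y} → 0# ≤ x → 0# ≤ y → x + y ≡ 1# → x ∈[0,1]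
  summand-∈[0,1] {x} {y} 0≤x 0≤y x+y≡1 = 0≤x , 0≤y-x⇒x≤y (subst (0# ≤_) y≡1-x 0≤y)
    where
      y≡1-x : y ≡ 1# - x
      y≡1-x = ≡.trans (solve 2 (λ x y → y := (x :+ y) :- x) ≡.refl x y) (cong (_- x) x+y≡1)

  Cube : ℝ → ℝ → ℝ → Set
  Cube x y z = x ∈[0,1] × y ∈[0,1] × z ∈[0,1]

  OnFace : ℝ → ℝ → ℝ → ℝ → Set
  OnFace e x y z = (x ≡ e × y ∈[0,1] × z ∈[0,1])
                 ⊎ (x ∈[0,1] × y ≡ e × z ∈[0,1])
                 ⊎ (x ∈[0,1] × y ∈[0,1] × z ≡ e)

  private
    1-0≡1 : 1# - 0# ≡ 1#
    1-0≡1 = solve 0 (con (+ 1) :- con (+ 0) := con (+ 1)) ≡.refl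

    ratio-nonneg : ∀ {d} (0<d : 0# < d) {x} → x ∈[0,1] → 0# ≤ x * recip 0<d
    ratio-nonneg 0<d (0≤x , _) = *-nonneg 0≤x (recip-nonneg 0<d)

  OnFace-cong : ∀ {e x y z x′ y′ z′} → x ≡ x′ → y ≡ y′ → z ≡ z′ → OnFace e x y z → OnFace e x′ y′ z′
  OnFace-cong ≡.refl ≡.refl ≡.refl face = face

  1-‿face : ∀ {x y z} → OnFace 0# x y z → OnFace 1# (1# - x) (1# - y) (1# - z)
  1-‿face (inj₁ (≡.refl , y∈ , z∈)) = inj₁ (1-0≡1 , 1-‿∈[0,1] y∈ , 1-‿∈[0,1] z∈)
  1-‿face (inj₂ (inj₁ (x∈ , ≡.refl , z∈))) = inj₂ (inj₁ (1-‿∈[0,1] x∈ , 1-0≡1 , 1-‿∈[0,1] z∈))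
  1-‿face (inj₂ (inj₂ (x∈ , y∈ , ≡.refl))) = inj₂ (inj₂ (1-‿∈[0,1] x∈ , 1-‿∈[0,1] y∈ , 1-0≡1))

  module _ {d} (0<d : 0# < d) where

    slide-to-zero : ∀ x → x + - (x * recip 0<d) * d ≡ 0#
    slide-to-zero x = begin
      x + - (x * recip 0<d) * d    ≡⟨ solve 3 (λ x u d → x :+ :- u :* d := x :- u :* d) ≡.refl x _ d ⟩
      x - x * recip 0<d * d        ≡⟨ cong (λ u → x - u) (recip-cancelʳ 0<d x) ⟩
      x - x                        ≡⟨ solve 1 (λ x → x :- x := con (+ 0)) ≡.refl x ⟩
      0#                           ∎
      where open ≡.≡-Reasoning

    slide-down-∈[0,1] : ∀ {r y} → 0# ≤ r → r ≤ y * recip 0<d → y ∈[0,1] → y + - r * d ∈[0,1]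
    slide-down-∈[0,1] {r} {y} 0≤r r≤y/d (_ , y≤1) =
      subst (0# ≤_) [y/d-r]d≡y-rd (*-nonneg (x≤y⇒0≤y-x r≤y/d) (inj₁ 0<d)) ,
      0≤y-x⇒x≤y (subst (0# ≤_) 1-y+rd≡1-[y-rd] (+-nonneg (x≤y⇒0≤y-x y≤1) (*-nonneg 0≤r (inj₁ 0<d))))
      where
        open ≡.≡-Reasoning
        [y/d-r]d≡y-rd : (y * recip 0<d - r) * d ≡ y + - r * d
        [y/d-r]d≡y-rd = begin
          (y * recip 0<d - r) * d          ≡⟨ solve 3 (λ u r d → (u :- r) :* d := u :* d :+ :- r :* d) ≡.refl _ r d ⟩
          y * recip 0<d * d + - r * d      ≡⟨ cong (_+ - r * d) (recip-cancelʳ 0<d y) ⟩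
          y + - r * d                      ∎
        1-y+rd≡1-[y-rd] : (1# - y) + r * d ≡ 1# - (y + - r * d)
        1-y+rd≡1-[y-rd] = solve 3 (λ y r d → (con (+ 1) :- y) :+ r :* d := con (+ 1) :- (y :+ :- r :* d)) ≡.refl y r d

  slide-to-face₀ : ∀ {a b c} → 0# < a → 0# < b → 0# < c → ∀ {x y z} → Cube x y z →
                   ∃[ t ] OnFace 0# (x + t * a) (y + t * b) (z + t * c)
  slide-to-face₀ 0<a 0<b 0<c {x} {y} {z} (x∈ , y∈ , z∈)
    with minimum₃ (x * recip 0<a) (y * recip 0<b) (z * recip 0<c)
  ... | inj₁ (x/a≤y/b , x/a≤z/c) =
    - (x * recip 0<a) ,
    inj₁ (slide-to-zero 0<a x , slide-down-∈[0,1] 0<b (ratio-nonneg 0<a x∈) x/a≤y/b y∈ ,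
                                slide-down-∈[0,1] 0<c (ratio-nonneg 0<a x∈) x/a≤z/c z∈)
  ... | inj₂ (inj₁ (y/b≤x/a , y/b≤z/c)) =
    - (y * recip 0<b) ,
    inj₂ (inj₁ (slide-down-∈[0,1] 0<a (ratio-nonneg 0<b y∈) y/b≤x/a x∈ , slide-to-zero 0<b y ,
                slide-down-∈[0,1] 0<c (ratio-nonneg 0<b y∈) y/b≤z/c z∈))
  ... | inj₂ (inj₂ (z/c≤x/a , z/c≤y/b)) =
    - (z * recip 0<c) ,
    inj₂ (inj₂ (slide-down-∈[0,1] 0<a (ratio-nonneg 0<c z∈) z/c≤x/a x∈ ,
                slide-down-∈[0,1] 0<b (ratio-nonneg 0<c z∈) z/c≤y/b y∈ , slide-to-zero 0<c z))

  -- Reflecting through the centre of the cube exchanges the faces at 0 and at 1.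
  slide-to-face₁ : ∀ {a b c} → 0# < a → 0# < b → 0# < c → ∀ {x y z} → Cube x y z →
                   ∃[ t ] OnFace 1# (x + t * a) (y + t * b) (z + t * c)
  slide-to-face₁ {a} {b} {c} 0<a 0<b 0<c {x} {y} {z} (x∈ , y∈ , z∈) =
    let t , face = slide-to-face₀ 0<a 0<b 0<c (1-‿∈[0,1] x∈ , 1-‿∈[0,1] y∈ , 1-‿∈[0,1] z∈)
    in - t , OnFace-cong (reflect x a t) (reflect y b t) (reflect z c t) (1-‿face face)
    where
      reflect : ∀ u d t → 1# - ((1# - u) + t * d) ≡ u + - t * d
      reflect = solve 3 (λ u d t → con (+ 1) :- ((con (+ 1) :- u) :+ t :* d) := u :+ :- t :* d) ≡.refl

  hexagon-marginals : (n : Fin 6 → ℝ) → (∀ i → 0# ≤ n i) → Σℝ n ≡ 1# →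
                      Cube (n 0F + n 1F + n 5F) (n 1F + n 2F + n 3F) (n 3F + n 4F + n 5F)
  hexagon-marginals n n≥0 Σn≡1 =
    summand-∈[0,1] (nonneg₃ 0F 1F 5F) (nonneg₃ 2F 3F 4F) (≡.trans split₁ Σn≡1) ,
    summand-∈[0,1] (nonneg₃ 1F 2F 3F) (nonneg₃ 0F 4F 5F) (≡.trans split₂ Σn≡1) ,
    summand-∈[0,1] (nonneg₃ 3F 4F 5F) (nonneg₃ 0F 1F 2F) (≡.trans split₃ Σn≡1)
    where
      nonneg₃ : ∀ i j k → 0# ≤ n i + n j + n k
      nonneg₃ i j k = +-nonneg (+-nonneg (n≥0 i) (n≥0 j)) (n≥0 k)

      n₀ n₁ n₂ n₃ n₄ n₅ : ℝ
      n₀ = n 0F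
      n₁ = n 1F
      n₂ = n 2F
      n₃ = n 3F
      n₄ = n 4F
      n₅ = n 5F

      total : ∀ {m} → (_ _ _ _ _ _ : Polynomial m) → Polynomial m
      total n₀ n₁ n₂ n₃ n₄ n₅ = n₀ :+ (n₁ :+ (n₂ :+ (n₃ :+ (n₄ :+ (n₅ :+ con (+ 0))))))

      split₁ : (n₀ + n₁ + n₅) + (n₂ + n₃ + n₄) ≡ Σℝ n
      split₁ = solve 6 (λ n₀ n₁ n₂ n₃ n₄ n₅ → (n₀ :+ n₁ :+ n₅) :+ (n₂ :+ n₃ :+ n₄) := total n₀ n₁ n₂ n₃ n₄ n₅)
                 ≡.refl n₀ n₁ n₂ n₃ n₄ n₅

      split₂ : (n₁ + n₂ + n₃) + (n₀ + n₄ + n₅) ≡ Σℝ n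
      split₂ = solve 6 (λ n₀ n₁ n₂ n₃ n₄ n₅ → (n₁ :+ n₂ :+ n₃) :+ (n₀ :+ n₄ :+ n₅) := total n₀ n₁ n₂ n₃ n₄ n₅)
                 ≡.refl n₀ n₁ n₂ n₃ n₄ n₅

      split₃ : (n₃ + n₄ + n₅) + (n₀ + n₁ + n₂) ≡ Σℝ n
      split₃ = solve 6 (λ n₀ n₁ n₂ n₃ n₄ n₅ → (n₃ :+ n₄ :+ n₅) :+ (n₀ :+ n₁ :+ n₂) := total n₀ n₁ n₂ n₃ n₄ n₅)
                 ≡.refl n₀ n₁ n₂ n₃ n₄ n₅

  hexagon-weights : ∀ {a b c} → 0# < a → 0# < b → 0# < c → ∀ {x y z} → Cube x y z →
    ∃[ n ] ∃[ t ] ((∀ i → 0# ≤ n i) × Σℝ n ≡ 1# ×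
                   n 0F + n 1F + n 5F ≡ x + t * a × n 1F + n 2F + n 3F ≡ y + t * b × n 3F + n 4F + n 5F ≡ z + t * c)
  hexagon-weights {a} {b} {c} 0<a 0<b 0<c {x} {y} {z} ((0≤x , x≤1) , (0≤y , y≤1) , (0≤z , z≤1)) =
    n₀ ∷ n₁ ∷ n₂ ∷ n₃ ∷ n₄ ∷ n₅ ∷ [] , shift , nonneg , total , coordinate₁ , coordinate₂ , coordinate₃
    where
      0<s : 0# < a + b + c
      0<s = +-pos (+-pos 0<a 0<b) 0<c
      σ : ℝ
      σ = recip 0<s
      open HexagonWeights rawRing x y z a b c σ

      vanish : ∀ u v → u + v * (σ * (a + b + c) - 1#) ≡ u
      vanish u v = ≡.trans (cong (λ e → u + v * (e - 1#)) (recip-inverse 0<s))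
                           (solve 2 (λ u v → u :+ v :* (con (+ 1) :- con (+ 1)) := u) ≡.refl u v)

      total : n₀ + (n₁ + (n₂ + (n₃ + (n₄ + (n₅ + 0#))))) ≡ 1#
      total = ≡.trans (solve 7 (λ x y z a b c σ → let module P = HexagonWeights (polynomialRawRing 7) x y z a b c σ in
        P.n₀ :+ (P.n₁ :+ (P.n₂ :+ (P.n₃ :+ (P.n₄ :+ (P.n₅ :+ con (+ 0))))))
          := con (+ 1) :+ (P.p₀₀₀ :+ P.p₁₁₁) :* (σ :* (a :+ b :+ c) :- con (+ 1))) ≡.refl x y z a b c σ) (vanish _ _)

      coordinate₁ : n₀ + n₁ + n₅ ≡ x + shift * a
      coordinate₁ = ≡.trans (solve 7 (λ x y z a b c σ → let module P = HexagonWeights (polynomialRawRing 7) x y z a b c σ in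
        P.n₀ :+ P.n₁ :+ P.n₅ := x :+ P.shift :* a :+ P.p₁₁₁ :* (σ :* (a :+ b :+ c) :- con (+ 1))) ≡.refl x y z a b c σ) (vanish _ _)

      coordinate₂ : n₁ + n₂ + n₃ ≡ y + shift * b
      coordinate₂ = ≡.trans (solve 7 (λ x y z a b c σ → let module P = HexagonWeights (polynomialRawRing 7) x y z a b c σ in
        P.n₁ :+ P.n₂ :+ P.n₃ := y :+ P.shift :* b :+ P.p₁₁₁ :* (σ :* (a :+ b :+ c) :- con (+ 1))) ≡.refl x y z a b c σ) (vanish _ _)

      coordinate₃ : n₃ + n₄ + n₅ ≡ z + shift * c
      coordinate₃ = ≡.trans (solve 7 (λ x y z a b c σ → let module P = HexagonWeights (polynomialRawRing 7) x y z a b c σ in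
        P.n₃ :+ P.n₄ :+ P.n₅ := z :+ P.shift :* c :+ P.p₁₁₁ :* (σ :* (a :+ b :+ c) :- con (+ 1))) ≡.refl x y z a b c σ) (vanish _ _)

      vertex-nonneg : ∀ {u v w} → 0# ≤ u → 0# ≤ v → 0# ≤ w → 0# ≤ u * v * w
      vertex-nonneg 0≤u 0≤v 0≤w = *-nonneg (*-nonneg 0≤u 0≤v) 0≤w

      weight-nonneg : ∀ {p q d} → 0# ≤ p → 0# ≤ q → 0# < d → 0# ≤ p + q * σ * d
      weight-nonneg 0≤p 0≤q 0<d = +-nonneg 0≤p (*-nonneg (*-nonneg 0≤q (recip-nonneg 0<s)) (inj₁ 0<d))

      0≤x′ : 0# ≤ x′
      0≤x′ = x≤y⇒0≤y-x x≤1
      0≤y′ : 0# ≤ y′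
      0≤y′ = x≤y⇒0≤y-x y≤1
      0≤z′ : 0# ≤ z′
      0≤z′ = x≤y⇒0≤y-x z≤1
      0≤p₀₀₀ : 0# ≤ p₀₀₀
      0≤p₀₀₀ = vertex-nonneg 0≤x′ 0≤y′ 0≤z′
      0≤p₁₁₁ : 0# ≤ p₁₁₁
      0≤p₁₁₁ = vertex-nonneg 0≤x 0≤y 0≤z

      nonneg : ∀ i → 0# ≤ (n₀ ∷ n₁ ∷ n₂ ∷ n₃ ∷ n₄ ∷ n₅ ∷ []) i
      nonneg 0F = weight-nonneg (vertex-nonneg 0≤x 0≤y′ 0≤z′) 0≤p₀₀₀ 0<a
      nonneg 1F = weight-nonneg (vertex-nonneg 0≤x 0≤y 0≤z′) 0≤p₁₁₁ 0<c
      nonneg 2F = weight-nonneg (vertex-nonneg 0≤x′ 0≤y 0≤z′) 0≤p₀₀₀ 0<b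
      nonneg 3F = weight-nonneg (vertex-nonneg 0≤x′ 0≤y 0≤z) 0≤p₁₁₁ 0<a
      nonneg 4F = weight-nonneg (vertex-nonneg 0≤x′ 0≤y′ 0≤z) 0≤p₀₀₀ 0<c
      nonneg 5F = weight-nonneg (vertex-nonneg 0≤x 0≤y′ 0≤z) 0≤p₁₁₁ 0<b

module Zonotopes (R : Reals) (w₁ w₂ w₃ : Plane.V2 R) where
  open Reals R
  open Plane R
  open RealsProperties R
  open UnitCube R
  open ≡.≡-Reasoning

  lincomb : ℝ → ℝ → ℝ → V2
  lincomb x y z = ((x · w₁) ⊕ (y · w₂)) ⊕ (z · w₃)

  Zonotope : V2 → Set
  Zonotope v = ∃[ x ] ∃[ y ] ∃[ z ] (Cube x y z × lincomb x y z ≡ v)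

  Parallelograms : V2 → Set
  Parallelograms = Union3 (Par w₂ w₃) (Par w₁ w₃) (Par w₁ w₂)

  TranslatedParallelograms : V2 → Set
  TranslatedParallelograms = Union3 (Tr w₁ (Par w₂ w₃)) (Tr w₂ (Par w₁ w₃)) (Tr w₃ (Par w₁ w₂))

  private
    coordinatewise : {f g : ℝ → ℝ → ℝ → ℝ} → (∀ u₁ u₂ u₃ → f u₁ u₂ u₃ ≡ g u₁ u₂ u₃) →
      _≡_ {A = V2} (f (proj₁ w₁) (proj₁ w₂) (proj₁ w₃) , f (proj₂ w₁) (proj₂ w₂) (proj₂ w₃))
                   (g (proj₁ w₁) (proj₁ w₂) (proj₁ w₃) , g (proj₂ w₁) (proj₂ w₂) (proj₂ w₃))
    coordinatewise e = cong₂ _,_ (e _ _ _) (e _ _ _)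

  lincomb-0₁ : ∀ y z → (y · w₂) ⊕ (z · w₃) ≡ lincomb 0# y z
  lincomb-0₁ y z = coordinatewise (solve 5 (λ y z u₁ u₂ u₃ →
    y :* u₂ :+ z :* u₃ := (con (+ 0) :* u₁ :+ y :* u₂) :+ z :* u₃) ≡.refl y z)

  lincomb-0₂ : ∀ x z → (x · w₁) ⊕ (z · w₃) ≡ lincomb x 0# z
  lincomb-0₂ x z = coordinatewise (solve 5 (λ x z u₁ u₂ u₃ →
    x :* u₁ :+ z :* u₃ := (x :* u₁ :+ con (+ 0) :* u₂) :+ z :* u₃) ≡.refl x z)

  lincomb-0₃ : ∀ x y → (x · w₁) ⊕ (y · w₂) ≡ lincomb x y 0#
  lincomb-0₃ x y = coordinatewise (solve 5 (λ x y u₁ u₂ u₃ →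
    x :* u₁ :+ y :* u₂ := (x :* u₁ :+ y :* u₂) :+ con (+ 0) :* u₃) ≡.refl x y)

  lincomb-1₁ : ∀ y z → w₁ ⊕ ((y · w₂) ⊕ (z · w₃)) ≡ lincomb 1# y z
  lincomb-1₁ y z = coordinatewise (solve 5 (λ y z u₁ u₂ u₃ →
    u₁ :+ (y :* u₂ :+ z :* u₃) := (con (+ 1) :* u₁ :+ y :* u₂) :+ z :* u₃) ≡.refl y z)

  lincomb-1₂ : ∀ x z → w₂ ⊕ ((x · w₁) ⊕ (z · w₃)) ≡ lincomb x 1# z
  lincomb-1₂ x z = coordinatewise (solve 5 (λ x z u₁ u₂ u₃ →
    u₂ :+ (x :* u₁ :+ z :* u₃) := (x :* u₁ :+ con (+ 1) :* u₂) :+ z :* u₃) ≡.refl x z)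

  lincomb-1₃ : ∀ x y → w₃ ⊕ ((x · w₁) ⊕ (y · w₂)) ≡ lincomb x y 1#
  lincomb-1₃ x y = coordinatewise (solve 5 (λ x y u₁ u₂ u₃ →
    u₃ :+ (x :* u₁ :+ y :* u₂) := (x :* u₁ :+ y :* u₂) :+ con (+ 1) :* u₃) ≡.refl x y)

  lincomb-slide : ∀ x y z t {a b c} →
                  lincomb (x + t * a) (y + t * b) (z + t * c) ≡ lincomb x y z ⊕ (t · lincomb a b c)
  lincomb-slide x y z t {a} {b} {c} = coordinatewise (solve 10 (λ x y z t a b c u₁ u₂ u₃ →
    ((x :+ t :* a) :* u₁ :+ (y :+ t :* b) :* u₂) :+ (z :+ t :* c) :* u₃
      := ((x :* u₁ :+ y :* u₂) :+ z :* u₃) :+ t :* ((a :* u₁ :+ b :* u₂) :+ c :* u₃)) ≡.refl x y z t a b c)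

  hexagon-sum : (n : Fin 6 → ℝ) →
    ΣV (λ i → n i · six w₁ w₂ w₃ i) ≡ lincomb (n 0F + n 1F + n 5F) (n 1F + n 2F + n 3F) (n 3F + n 4F + n 5F)
  hexagon-sum n = coordinatewise (solve 9 (λ n₀ n₁ n₂ n₃ n₄ n₅ u₁ u₂ u₃ →
    n₀ :* u₁ :+ (n₁ :* (u₁ :+ u₂) :+ (n₂ :* u₂ :+ (n₃ :* (u₂ :+ u₃) :+ (n₄ :* u₃ :+ (n₅ :* (u₁ :+ u₃) :+ con (+ 0))))))
      := ((n₀ :+ n₁ :+ n₅) :* u₁ :+ (n₁ :+ n₂ :+ n₃) :* u₂) :+ (n₃ :+ n₄ :+ n₅) :* u₃)
    ≡.refl (n 0F) (n 1F) (n 2F) (n 3F) (n 4F) (n 5F))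

  Parallelograms⊆Zonotope : Parallelograms ⊆ Zonotope
  Parallelograms⊆Zonotope (inj₁ (y , z , 0≤y , y≤1 , 0≤z , z≤1 , eq)) =
    0# , y , z , (0∈[0,1] , (0≤y , y≤1) , (0≤z , z≤1)) , ≡.trans (≡.sym (lincomb-0₁ y z)) eq
  Parallelograms⊆Zonotope (inj₂ (inj₁ (x , z , 0≤x , x≤1 , 0≤z , z≤1 , eq))) =
    x , 0# , z , ((0≤x , x≤1) , 0∈[0,1] , (0≤z , z≤1)) , ≡.trans (≡.sym (lincomb-0₂ x z)) eq
  Parallelograms⊆Zonotope (inj₂ (inj₂ (x , y , 0≤x , x≤1 , 0≤y , y≤1 , eq))) =
    x , y , 0# , ((0≤x , x≤1) , (0≤y , y≤1) , 0∈[0,1]) , ≡.trans (≡.sym (lincomb-0₃ x y)) eq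

  TranslatedParallelograms⊆Zonotope : TranslatedParallelograms ⊆ Zonotope
  TranslatedParallelograms⊆Zonotope (inj₁ (_ , (y , z , 0≤y , y≤1 , 0≤z , z≤1 , ≡.refl) , eq)) =
    1# , y , z , (1∈[0,1] , (0≤y , y≤1) , (0≤z , z≤1)) , ≡.trans (≡.sym (lincomb-1₁ y z)) eq
  TranslatedParallelograms⊆Zonotope (inj₂ (inj₁ (_ , (x , z , 0≤x , x≤1 , 0≤z , z≤1 , ≡.refl) , eq))) =
    x , 1# , z , ((0≤x , x≤1) , 1∈[0,1] , (0≤z , z≤1)) , ≡.trans (≡.sym (lincomb-1₂ x z)) eq
  TranslatedParallelograms⊆Zonotope (inj₂ (inj₂ (_ , (x , y , 0≤x , x≤1 , 0≤y , y≤1 , ≡.refl) , eq))) =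
    x , y , 1# , ((0≤x , x≤1) , (0≤y , y≤1) , 1∈[0,1]) , ≡.trans (≡.sym (lincomb-1₃ x y)) eq

  face₀⇒Parallelograms : ∀ {x y z} → OnFace 0# x y z → Parallelograms (lincomb x y z)
  face₀⇒Parallelograms (inj₁ (≡.refl , (0≤y , y≤1) , (0≤z , z≤1))) =
    inj₁ (_ , _ , 0≤y , y≤1 , 0≤z , z≤1 , lincomb-0₁ _ _)
  face₀⇒Parallelograms (inj₂ (inj₁ ((0≤x , x≤1) , ≡.refl , (0≤z , z≤1)))) =
    inj₂ (inj₁ (_ , _ , 0≤x , x≤1 , 0≤z , z≤1 , lincomb-0₂ _ _))
  face₀⇒Parallelograms (inj₂ (inj₂ ((0≤x , x≤1) , (0≤y , y≤1) , ≡.refl))) =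
    inj₂ (inj₂ (_ , _ , 0≤x , x≤1 , 0≤y , y≤1 , lincomb-0₃ _ _))

  face₁⇒TranslatedParallelograms : ∀ {x y z} → OnFace 1# x y z → TranslatedParallelograms (lincomb x y z)
  face₁⇒TranslatedParallelograms (inj₁ (≡.refl , (0≤y , y≤1) , (0≤z , z≤1))) =
    inj₁ (_ , (_ , _ , 0≤y , y≤1 , 0≤z , z≤1 , ≡.refl) , lincomb-1₁ _ _)
  face₁⇒TranslatedParallelograms (inj₂ (inj₁ ((0≤x , x≤1) , ≡.refl , (0≤z , z≤1)))) =
    inj₂ (inj₁ (_ , (_ , _ , 0≤x , x≤1 , 0≤z , z≤1 , ≡.refl) , lincomb-1₂ _ _))
  face₁⇒TranslatedParallelograms (inj₂ (inj₂ ((0≤x , x≤1) , (0≤y , y≤1) , ≡.refl))) =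
    inj₂ (inj₂ (_ , (_ , _ , 0≤x , x≤1 , 0≤y , y≤1 , ≡.refl) , lincomb-1₃ _ _))

  H⊆Zonotope : H w₁ w₂ w₃ ⊆ Zonotope
  H⊆Zonotope (n , n≥0 , Σn≡1 , eq) = _ , _ , _ , hexagon-marginals n n≥0 Σn≡1 , ≡.trans (≡.sym (hexagon-sum n)) eq

  module PositiveDependence {a b c} (0<a : 0# < a) (0<b : 0# < b) (0<c : 0# < c) (dependence : lincomb a b c ≡ 𝟎) where

    slide-invariant : ∀ x y z t → lincomb (x + t * a) (y + t * b) (z + t * c) ≡ lincomb x y z
    slide-invariant x y z t = begin
      lincomb (x + t * a) (y + t * b) (z + t * c)  ≡⟨ lincomb-slide x y z t ⟩
      lincomb x y z ⊕ (t · lincomb a b c)          ≡⟨ cong (λ v → lincomb x y z ⊕ (t · v)) dependence ⟩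
      lincomb x y z ⊕ (t · 𝟎)                      ≡⟨ cong₂ _,_ (v+t0≡v _) (v+t0≡v _) ⟩
      lincomb x y z                                ∎
      where
        v+t0≡v : ∀ v → v + t * 0# ≡ v
        v+t0≡v v = solve 2 (λ v t → v :+ t :* con (+ 0) := v) ≡.refl v t

    Zonotope⊆Parallelograms : Zonotope ⊆ Parallelograms
    Zonotope⊆Parallelograms (x , y , z , cube , ≡.refl) =
      let t , face = slide-to-face₀ 0<a 0<b 0<c cube
      in subst Parallelograms (slide-invariant x y z t) (face₀⇒Parallelograms face)

    Zonotope⊆TranslatedParallelograms : Zonotope ⊆ TranslatedParallelograms
    Zonotope⊆TranslatedParallelograms (x , y , z , cube , ≡.refl) =
      let t , face = slide-to-face₁ 0<a 0<b 0<c cube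
      in subst TranslatedParallelograms (slide-invariant x y z t) (face₁⇒TranslatedParallelograms face)

    Zonotope⊆H : Zonotope ⊆ H w₁ w₂ w₃
    Zonotope⊆H (x , y , z , cube , ≡.refl) =
      let n , t , n≥0 , Σn≡1 , n₁₂₆ , n₂₃₄ , n₄₅₆ = hexagon-weights 0<a 0<b 0<c cube
      in n , n≥0 , Σn≡1 , (begin
        ΣV (λ i → n i · six w₁ w₂ w₃ i)                         ≡⟨ hexagon-sum n ⟩
        lincomb (n 0F + n 1F + n 5F) (n 1F + n 2F + n 3F) (n 3F + n 4F + n 5F)
                                                                ≡⟨ cong₂ (λ u → uncurry (lincomb u)) n₁₂₆ (cong₂ _,_ n₂₃₄ n₄₅₆) ⟩
        lincomb (x + t * a) (y + t * b) (z + t * c)             ≡⟨ slide-invariant x y z t ⟩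
        lincomb x y z                                           ∎)

SetEq-via : (R : Reals) → let open Plane R in
  ∀ {A B C : V2 → Set} → A ⊆ C → C ⊆ A → B ⊆ C → C ⊆ B → SetEq A B
SetEq-via R A⊆C C⊆A B⊆C C⊆B v = mk⇔ (λ a → C⊆B (A⊆C a)) (λ b → C⊆A (B⊆C b))

lemma12 : (R : Reals) → let open Plane R in
    ∀ w₁ w₂ w₃ → PositivelyDependent w₁ w₂ w₃ →
    SetEq (H w₁ w₂ w₃) (Union3 (Par w₂ w₃) (Par w₁ w₃) (Par w₁ w₂)) ×
    SetEq (Union3 (Par w₂ w₃) (Par w₁ w₃) (Par w₁ w₂))
          (Union3 (Tr w₁ (Par w₂ w₃)) (Tr w₂ (Par w₁ w₃)) (Tr w₃ (Par w₁ w₂)))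
lemma12 R w₁ w₂ w₃ (_ , a , b , c , 0<a , 0<b , 0<c , dependence) =
  SetEq-via R H⊆Zonotope Zonotope⊆H Parallelograms⊆Zonotope Zonotope⊆Parallelograms ,
  SetEq-via R Parallelograms⊆Zonotope Zonotope⊆Parallelograms
              TranslatedParallelograms⊆Zonotope Zonotope⊆TranslatedParallelograms
  where
    open Zonotopes R w₁ w₂ w₃
    open PositiveDependence 0<a 0<b 0<c dependence
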